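{- Let $T$ be a tree rooted at a vertex $r$ such that $d_T(x)\le 2$ for every vertex $x\neq r$, $1\le |N_T(r)\cap L_T|\le d_T(r)-1$, and $d_T(x,r)\equiv 2 \pmod 3$ for every leaf $x\in L_T\setminus N_T(r)$. Then $T$ is a DTDP-graph. In particular, if $T$ is a tree rooted at $r$ with $d_T(x)\le 2$ for all $x\ne r$, $1\le |N_T(r)\cap L_T|\le d_T(r)-1$ and $d_T(x,r)=2$ for every leaf $x\in L_T\setminus N_T(r)$ (a wounded spider), then $T$ is a minimal DTDP-graph.
   Context: $d_T(x)$ is the degree of $x$, $d_T(x,r)$ the distance between $x$ and $r$, $N_T(r)$ the set of neighbours of $r$, and $L_T$ the set of leaves (vertices of degree 1) of $T$. A set $D$ is dominating if every vertex not in $D$ has a neighbour in $D$; a set $S$ is total dominating if every vertex (including those in $S$) has a neighbour in $S$. A DT-pair is a pair of disjoint vertex sets $(D,S)$ with $D$ dominating and $S$ total dominating; a graph is a DTDP-graph if it has a DT-pair. A connected graph is a minimal DTDP-graph if it is a DTDP-graph and no proper spanning subgraph (same vertex set, proper subset of edges) is a DTDP-graph. -}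

module Defs where

open import Data.Nat using (ℕ; zero; suc; _+_; _≤_; _<_)
open import Data.Nat.DivMod using (_%_)
open import Data.Fin using (Fin; toℕ)
open import Data.Bool using (Bool; true; false; if_then_else_; _∧_)
open import Data.List using (List; map; allFin)
open import Data.Nat.ListAction using (sum)
open import Data.Product using (Σ; ∃; _×_; _,_)
open import Data.Sum using (_⊎_)
open import Relation.Binary.PropositionalEquality using (_≡_)
open import Relation.Nullary using (¬_)
open import Function.Definitions using (Injective)

record Graph (n : ℕ) : Set where
  field
    adj    : Fin n → Fin n → Bool
    sym    : ∀ x y → adj x y ≡ adj y x
    irrefl : ∀ x → adj x x ≡ false
open Graph public

module _ {n : ℕ} (G : Graph n) where

  ind : Bool → ℕ
  ind b = if b then 1 else 0

  deg : Fin n → ℕ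
  deg x = sum (map (λ y → ind (adj G x y)) (allFin n))

  isLeaf : Fin n → Bool
  isLeaf x with deg x
  ... | 1 = true
  ... | _ = false

  leafNbrs : Fin n → ℕ
  leafNbrs r = sum (map (λ y → ind (adj G r y ∧ isLeaf y)) (allFin n))

  data Walk : Fin n → Fin n → ℕ → Set where
    here : ∀ {x} → Walk x x 0
    step : ∀ {x y z k} → adj G x y ≡ true → Walk y z k → Walk x z (suc k)

  -- d_G(x,y) ≡ k : shortest walk (= shortest path) length
  Dist : Fin n → Fin n → ℕ → Set
  Dist x y k = Walk x y k × (∀ m → Walk x y m → k ≤ m)

  Connected : Set
  Connected = ∀ x y → ∃ λ k → Walk x y k

  Cycle : Set
  Cycle = Σ ℕ λ m → 3 ≤ m × Σ (Fin m → Fin n) λ f → Injective _≡_ _≡_ f ×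
            (∀ (i j : Fin m) → (suc (toℕ i) ≡ toℕ j ⊎ (suc (toℕ i) ≡ m × toℕ j ≡ 0))
               → adj G (f i) (f j) ≡ true)

  IsTree : Set
  IsTree = Connected × ¬ Cycle

  Dominating : (Fin n → Bool) → Set
  Dominating D = ∀ x → D x ≡ false → ∃ λ y → adj G x y ≡ true × D y ≡ true

  TotalDominating : (Fin n → Bool) → Set
  TotalDominating S = ∀ x → ∃ λ y → adj G x y ≡ true × S y ≡ true

  Disjoint : (Fin n → Bool) → (Fin n → Bool) → Set
  Disjoint D S = ∀ x → ¬ (D x ≡ true × S x ≡ true)

  DTPair : (Fin n → Bool) → (Fin n → Bool) → Set
  DTPair D S = Disjoint D S × Dominating D × TotalDominating S

  DTDP : Set
  DTDP = Σ (Fin n → Bool) λ D → Σ (Fin n → Bool) λ S → DTPair D S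

ProperSpanningSubgraph : {n : ℕ} → Graph n → Graph n → Set
ProperSpanningSubgraph {n} H G =
  (∀ x y → adj H x y ≡ true → adj G x y ≡ true) ×
  (∃ λ x → ∃ λ y → adj G x y ≡ true × adj H x y ≡ false)

MinimalDTDP : {n : ℕ} → Graph n → Set
MinimalDTDP {n} G = Connected G × DTDP G × (∀ (H : Graph n) → ProperSpanningSubgraph H G → ¬ DTDP H)

-- Root the tree at r and let D consist of the vertices whose depth is 2 modulo 3 together with
-- the leaves adjacent to r; S is the complement of D. Along every path down from r the pattern
-- S S D S S D ... works: a vertex of depth 1 (mod 3) is dominated by its child and totally
-- dominated by its parent, one of depth 2 (mod 3) is totally dominated by its parent, and one of
-- depth 0 (mod 3) is dominated by its parent and totally dominated by its child. Children exist
-- where needed because every leaf away from r has depth 2 (mod 3); r itself sees a leaf (in D)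
-- and a non-leaf (in S) among its neighbours.
-- In a wounded spider every edge joins a vertex to its parent, and deleting it leaves either an
-- isolated vertex or an isolated edge, neither of which has a DT-pair.
-- The tree structure is used only through depths: a neighbour of x that is not deeper than x must
-- be the parent of x, since otherwise the two root paths close up into a cycle.

module Submission where

open import Defs hiding (sym)
open import Data.Nat using (ℕ; zero; suc; _+_; _≤_; _<_; _∸_; z≤n; s≤s; _≟_; _≤?_; _<?_)
open import Data.Nat.Properties
open import Data.Nat.DivMod using (_%_)
open import Data.Fin using (Fin; zero; suc; toℕ; punchIn; punchOut)
open import Data.Fin.Properties
  using (any?; toℕ-injective; toℕ<n; punchInᵢ≢i; punchIn-punchOut; punchOut-injective)
  renaming (_≟_ to _≟ᶠ_)
open import Data.Bool using (Bool; true; false; if_then_else_; _∧_; _∨_; not)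
open import Data.Bool.Properties
  using (∨-zeroʳ; ∧-zeroʳ; ∧-conicalˡ; ∧-conicalʳ; ¬-not; not-¬)
  renaming (_≟_ to _≟ᵇ_)
open import Data.List using (map; allFin; tabulate)
open import Data.List.Properties using (map-tabulate)
open import Data.Nat.ListAction using (sum)
open import Data.List.Extrema.Nat using (argmax; f[xs]≤f[argmax])
import Data.List.Relation.Unary.All as All
open import Data.List.Membership.Propositional.Properties using (∈-allFin)
open import Data.Product using (∃; _×_; _,_; proj₁; proj₂)
open import Data.Sum using (_⊎_; inj₁; inj₂)
open import Data.Empty using (⊥)
open import Function using (_∘_; id)
open import Function.Definitions using (Injective)
open import Relation.Nullary using (¬_; Dec; yes; no; does; contradiction)
open import Relation.Nullary.Decidable using (_×-dec_; ¬?; dec-true; dec-false)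
open import Relation.Unary using (Decidable)
open import Relation.Binary.PropositionalEquality
open import Algebra.Properties.CommutativeSemigroup +-commutativeSemigroup using (x∙yz≈y∙xz)

indicator : Bool → ℕ
indicator b = if b then 1 else 0

count : ∀ {n} → (Fin n → Bool) → ℕ
count f = sum (tabulate (indicator ∘ f))

sum-allFin≡count : ∀ {n} (f : Fin n → Bool) → sum (map (indicator ∘ f) (allFin n)) ≡ count f
sum-allFin≡count f = cong sum (map-tabulate id (indicator ∘ f))

count-punchIn : ∀ {n} (f : Fin (suc n) → Bool) i → count f ≡ indicator (f i) + count (f ∘ punchIn i)
count-punchIn f zero = refl
count-punchIn {suc n} f (suc i) = begin
  indicator (f zero) + count (f ∘ suc)
    ≡⟨ cong (indicator (f zero) +_) (count-punchIn (f ∘ suc) i) ⟩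
  indicator (f zero) + (indicator (f (suc i)) + count (f ∘ suc ∘ punchIn i))
    ≡⟨ x∙yz≈y∙xz (indicator (f zero)) (indicator (f (suc i))) _ ⟩
  indicator (f (suc i)) + count (f ∘ punchIn (suc i)) ∎
  where open ≡-Reasoning

count≡0 : ∀ {n} (f : Fin n → Bool) → (∀ y → f y ≡ false) → count f ≡ 0
count≡0 {zero}  f none = refl
count≡0 {suc n} f none rewrite none zero = count≡0 (f ∘ suc) (none ∘ suc)

count-mono : ∀ {n} (f g : Fin n → Bool) → (∀ y → f y ≡ true → g y ≡ true) → count f ≤ count g
count-mono {zero}  f g f⇒g = z≤n
count-mono {suc n} f g f⇒g = +-mono-≤ (indicator-mono (f zero) (g zero) (f⇒g zero))
                                      (count-mono (f ∘ suc) (g ∘ suc) (f⇒g ∘ suc))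
  where
  indicator-mono : ∀ a b → (a ≡ true → b ≡ true) → indicator a ≤ indicator b
  indicator-mono false b _   = z≤n
  indicator-mono true  b a⇒b rewrite a⇒b refl = ≤-refl

1≤count⇒∃ : ∀ {n} (f : Fin n → Bool) → 1 ≤ count f → ∃ λ y → f y ≡ true
1≤count⇒∃ {suc n} f 1≤c with f zero in fz
... | true  = zero , fz
... | false = let y , fy = 1≤count⇒∃ (f ∘ suc) 1≤c in suc y , fy

1≤count : ∀ {n} (f : Fin n → Bool) {a} → f a ≡ true → 1 ≤ count f
1≤count {suc n} f {a} fa rewrite count-punchIn f a | fa = s≤s z≤n

punchIn-punchOut-true : ∀ {n} (f : Fin (suc n) → Bool) {a b} (a≢b : a ≢ b) →
                        f b ≡ true → (f ∘ punchIn a) (punchOut a≢b) ≡ true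
punchIn-punchOut-true f a≢b fb = trans (cong f (punchIn-punchOut a≢b)) fb

2≤count : ∀ {n} (f : Fin n → Bool) {a b} → f a ≡ true → f b ≡ true → a ≢ b → 2 ≤ count f
2≤count {suc n} f {a} fa fb a≢b rewrite count-punchIn f a | fa =
  s≤s (1≤count (f ∘ punchIn a) (punchIn-punchOut-true f a≢b fb))

3≤count : ∀ {n} (f : Fin n → Bool) {a b c} → f a ≡ true → f b ≡ true → f c ≡ true →
          a ≢ b → a ≢ c → b ≢ c → 3 ≤ count f
3≤count {suc n} f {a} fa fb fc a≢b a≢c b≢c rewrite count-punchIn f a | fa =
  s≤s (2≤count (f ∘ punchIn a) (punchIn-punchOut-true f a≢b fb) (punchIn-punchOut-true f a≢c fc)
                (b≢c ∘ punchOut-injective a≢b a≢c))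

count≡1 : ∀ {n} (f : Fin n → Bool) {a} → f a ≡ true → (∀ y → f y ≡ true → y ≡ a) → count f ≡ 1
count≡1 {suc n} f {a} fa unique rewrite count-punchIn f a | fa =
  cong suc (count≡0 (f ∘ punchIn a) others)
  where
  others : ∀ y → f (punchIn a y) ≡ false
  others y with f (punchIn a y) in fy
  ... | false = refl
  ... | true  = contradiction (unique _ fy) (punchInᵢ≢i a y)

count≡1-unique : ∀ {n} (f : Fin n → Bool) {a b} → count f ≡ 1 → f a ≡ true → f b ≡ true → a ≡ b
count≡1-unique f {a} {b} c≡1 fa fb with a ≟ᶠ b
... | yes a≡b = a≡b
... | no  a≢b = contradiction (subst (2 ≤_) c≡1 (2≤count f fa fb a≢b)) (1+n≰n {1})

module Neighbourhood {n : ℕ} (G : Graph n) where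

  adj-sym : ∀ {x y} → adj G x y ≡ true → adj G y x ≡ true
  adj-sym {x} {y} = trans (Graph.sym G y x)

  adj⇒≢ : ∀ {x y} → adj G x y ≡ true → x ≢ y
  adj⇒≢ {x} xy refl = contradiction (Graph.irrefl G x) (not-¬ xy)

  deg≡count : ∀ x → deg G x ≡ count (adj G x)
  deg≡count x = sum-allFin≡count (adj G x)

  isLeaf⇒deg≡1 : ∀ {x} → isLeaf G x ≡ true → deg G x ≡ 1
  isLeaf⇒deg≡1 {x} leaf with deg G x | leaf
  ... | 1 | _ = refl

  deg≡1⇒isLeaf : ∀ {x} → deg G x ≡ 1 → isLeaf G x ≡ true
  deg≡1⇒isLeaf {x} d≡1 with deg G x | d≡1
  ... | 1 | _ = refl

  leaf-neighbour-unique : ∀ {x a b} → isLeaf G x ≡ true → adj G x a ≡ true → adj G x b ≡ true → a ≡ b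
  leaf-neighbour-unique {x} leaf =
    count≡1-unique (adj G x) (trans (sym (deg≡count x)) (isLeaf⇒deg≡1 leaf))

  two-neighbours⇒¬leaf : ∀ {x a b} → adj G x a ≡ true → adj G x b ≡ true → a ≢ b → isLeaf G x ≡ false
  two-neighbours⇒¬leaf {x} xa xb a≢b with isLeaf G x in leaf
  ... | false = refl
  ... | true  = contradiction (leaf-neighbour-unique leaf xa xb) a≢b

  nonLeaf⇒other-neighbour : ∀ {x p} → adj G x p ≡ true → isLeaf G x ≡ false →
                            ∃ λ c → adj G x c ≡ true × c ≢ p
  nonLeaf⇒other-neighbour {x} {p} xp nonLeaf
    with any? (λ c → (adj G x c ≟ᵇ true) ×-dec ¬? (c ≟ᶠ p))
  ... | yes (c , xc , c≢p) = c , xc , c≢p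
  ... | no  ∄c = contradiction nonLeaf (not-¬ (deg≡1⇒isLeaf (trans (deg≡count x) deg≡1)))
    where
    only-p : ∀ y → adj G x y ≡ true → y ≡ p
    only-p y xy with y ≟ᶠ p
    ... | yes y≡p = y≡p
    ... | no  y≢p = contradiction (y , xy , y≢p) ∄c
    deg≡1 : count (adj G x) ≡ 1
    deg≡1 = count≡1 (adj G x) xp only-p

  deg≤2⇒neighbour∈ : ∀ {x a b c} → deg G x ≤ 2 → adj G x a ≡ true → adj G x b ≡ true →
                     adj G x c ≡ true → a ≢ b → c ≡ a ⊎ c ≡ b
  deg≤2⇒neighbour∈ {x} {a} {b} {c} d≤2 xa xb xc a≢b with c ≟ᶠ a | c ≟ᶠ b
  ... | yes c≡a | _       = inj₁ c≡a
  ... | no  _   | yes c≡b = inj₂ c≡b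
  ... | no  c≢a | no  c≢b = contradiction
    (≤-trans (3≤count (adj G x) xa xb xc a≢b (c≢a ∘ sym) (c≢b ∘ sym)) (subst (_≤ 2) (deg≡count x) d≤2))
    (1+n≰n {2})

  leafNbrs≡count : ∀ r → leafNbrs G r ≡ count (λ y → adj G r y ∧ isLeaf G y)
  leafNbrs≡count r = sum-allFin≡count (λ y → adj G r y ∧ isLeaf G y)

  leaf-neighbour : ∀ r → 1 ≤ leafNbrs G r → ∃ λ y → adj G r y ≡ true × isLeaf G y ≡ true
  leaf-neighbour r 1≤l with 1≤count⇒∃ _ (subst (1 ≤_) (leafNbrs≡count r) 1≤l)
  ... | y , ry∧leaf = y , ∧-conicalˡ _ _ ry∧leaf , ∧-conicalʳ _ _ ry∧leaf

  nonLeaf-neighbour : ∀ r → 1 ≤ leafNbrs G r → leafNbrs G r ≤ deg G r ∸ 1 →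
                      ∃ λ y → adj G r y ≡ true × isLeaf G y ≡ false
  nonLeaf-neighbour r 1≤l l≤d∸1 with any? (λ y → (adj G r y ≟ᵇ true) ×-dec (isLeaf G y ≟ᵇ false))
  ... | yes found = found
  ... | no  ∄y    = contradiction (≤-trans d≤l l≤d∸1) (<⇒≱ (∸-monoʳ-< {o = 0} (s≤s z≤n) 1≤d))
    where
    all-leaves : ∀ y → adj G r y ≡ true → (adj G r y ∧ isLeaf G y) ≡ true
    all-leaves y ry with isLeaf G y in leaf
    ... | true  = cong (_∧ true) ry
    ... | false = contradiction (y , ry , leaf) ∄y
    d≤l : deg G r ≤ leafNbrs G r
    d≤l = subst₂ _≤_ (sym (deg≡count r)) (sym (leafNbrs≡count r)) (count-mono _ _ all-leaves)
    1≤d : 1 ≤ deg G r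
    1≤d = let y , ry , _ = leaf-neighbour r 1≤l in subst (1 ≤_) (sym (deg≡count r)) (1≤count (adj G r) ry)

%3-consecutive : ∀ m → (m % 3 ≡ 0 × suc m % 3 ≡ 1 × suc (suc m) % 3 ≡ 2)
                     ⊎ (m % 3 ≡ 1 × suc m % 3 ≡ 2 × suc (suc m) % 3 ≡ 0)
                     ⊎ (m % 3 ≡ 2 × suc m % 3 ≡ 0 × suc (suc m) % 3 ≡ 1)
%3-consecutive 0                   = inj₁ (refl , refl , refl)
%3-consecutive 1                   = inj₂ (inj₁ (refl , refl , refl))
%3-consecutive 2                   = inj₂ (inj₂ (refl , refl , refl))
%3-consecutive (suc (suc (suc m))) = %3-consecutive m

least : ∀ {p} {P : ℕ → Set p} → Decidable P → ∀ {N} → P N → ∃ λ j → P j × (∀ t → t < j → ¬ P t)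
least P? {zero}  pN = zero , pN , λ _ ()
least P? {suc N} pN with P? zero
... | yes p0 = zero , p0 , λ _ ()
... | no ¬p0 with least (P? ∘ suc) pN
...   | j , pj , below = suc j , pj , λ { zero _ → ¬p0 ; (suc t) (s≤s t<j) → below t t<j }

module Depth {n : ℕ} (G : Graph n) (r : Fin n) (connected : Connected G) where
  open Neighbourhood G

  walk? : ∀ x z m → Dec (Walk G x z m)
  walk? x z zero with x ≟ᶠ z
  ... | yes refl = yes here
  ... | no  x≢z  = no λ { here → x≢z refl }
  walk? x z (suc m) with any? (λ y → (adj G x y ≟ᵇ true) ×-dec walk? y z m)
  ... | yes (y , xy , w) = yes (step xy w)
  ... | no  ∄y           = no λ { (step xy w) → ∄y (_ , xy , w) }

  abstract
   distance-to-root : ∀ x → ∃ λ k → Dist G x r k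
   distance-to-root x with connected x r
   ... | _ , w with least (walk? x r) w
   ...   | j , wj , below = j , wj , λ m wm → ≮⇒≥ (λ m<j → below m m<j wm)

  depth : Fin n → ℕ
  depth x = proj₁ (distance-to-root x)

  depth-dist : ∀ x → Dist G x r (depth x)
  depth-dist x = proj₂ (distance-to-root x)

  depth-walk : ∀ x → Walk G x r (depth x)
  depth-walk x = proj₁ (depth-dist x)

  depth-minimal : ∀ x {m} → Walk G x r m → depth x ≤ m
  depth-minimal x = proj₂ (depth-dist x) _

  depth-adj : ∀ {x y} → adj G x y ≡ true → depth x ≤ suc (depth y)
  depth-adj {x} {y} xy = depth-minimal x (step xy (depth-walk y))

  depth≡0⇒root : ∀ {x} → depth x ≡ 0 → x ≡ r
  depth≡0⇒root {x} d≡0 with depth x | depth-walk x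
  depth≡0⇒root refl | zero | here = refl

  depth-root : depth r ≡ 0
  depth-root = n≤0⇒n≡0 (depth-minimal r here)

  depth-nonroot : ∀ {x} → x ≢ r → ∃ λ k → depth x ≡ suc k
  depth-nonroot {x} x≢r with depth x in d
  ... | zero  = contradiction (depth≡0⇒root d) x≢r
  ... | suc k = k , refl

  adj-root⇒depth≡1 : ∀ {y} → adj G r y ≡ true → depth y ≡ 1
  adj-root⇒depth≡1 {y} ry with depth-nonroot (adj⇒≢ ry ∘ sym)
  ... | k , d≡1+k = ≤-antisym (subst (depth y ≤_) (cong suc depth-root) (depth-adj (adj-sym ry)))
                              (subst (1 ≤_) (sym d≡1+k) (s≤s z≤n))

  first-step : ∀ {x z m} → Walk G x z m → Fin n
  first-step {x} here         = x
  first-step (step {y = y} _ _) = y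

  first-step-spec : ∀ {x z m k} (w : Walk G x z m) → m ≡ suc k →
                    adj G x (first-step w) ≡ true × Walk G (first-step w) z k
  first-step-spec (step xy w) refl = xy , w

  parent : Fin n → Fin n
  parent x = first-step (depth-walk x)

  parent-adj : ∀ {x k} → depth x ≡ suc k → adj G x (parent x) ≡ true
  parent-adj {x} d≡1+k = proj₁ (first-step-spec (depth-walk x) d≡1+k)

  depth-parent : ∀ {x k} → depth x ≡ suc k → depth (parent x) ≡ k
  depth-parent {x} d≡1+k = ≤-antisym
    (depth-minimal (parent x) (proj₂ (first-step-spec (depth-walk x) d≡1+k)))
    (≤-pred (subst (_≤ suc (depth (parent x))) d≡1+k (depth-adj (parent-adj d≡1+k))))

  ancestor : ℕ → Fin n → Fin n
  ancestor zero    x = x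
  ancestor (suc t) x = parent (ancestor t x)

  depth-ancestor : ∀ t x → t ≤ depth x → depth (ancestor t x) ≡ depth x ∸ t
  depth-ancestor zero    x _   = refl
  depth-ancestor (suc t) x t<d =
    depth-parent (trans (depth-ancestor t x (<⇒≤ t<d)) (+-∸-assoc 1 t<d))

  ancestor-adj : ∀ t x → t < depth x → adj G (ancestor t x) (ancestor (suc t) x) ≡ true
  ancestor-adj t x t<d = parent-adj (trans (depth-ancestor t x (<⇒≤ t<d)) (+-∸-assoc 1 t<d))

  ancestor-depth≡root : ∀ x → ancestor (depth x) x ≡ r
  ancestor-depth≡root x = depth≡0⇒root (trans (depth-ancestor (depth x) x ≤-refl) (n∸n≡0 (depth x)))

  ancestor-injective : ∀ x {s t} → s ≤ depth x → t ≤ depth x → ancestor s x ≡ ancestor t x → s ≡ t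
  ancestor-injective x {s} {t} s≤d t≤d eq = ∸-cancelˡ-≡ s≤d t≤d
    (trans (sym (depth-ancestor s x s≤d)) (trans (cong depth eq) (depth-ancestor t x t≤d)))

module Paths {n : ℕ} (G : Graph n) where
  open Neighbourhood G

  record Path (len : ℕ) : Set where
    field
      vertex    : ℕ → Fin n
      linked    : ∀ t → t < len → adj G (vertex t) (vertex (suc t)) ≡ true
      injective : ∀ {s t} → s ≤ len → t ≤ len → vertex s ≡ vertex t → s ≡ t
  open Path public

  reverse : ∀ {len} → Path len → Path len
  reverse {len} p = record
    { vertex    = λ t → vertex p (len ∸ t)
    ; linked    = λ t t<len → subst (λ s → adj G (vertex p s) (vertex p (len ∸ suc t)) ≡ true)
                                    (sym (+-∸-assoc 1 t<len))
                                    (adj-sym (linked p (len ∸ suc t) (∸-monoʳ-< {o = 0} (s≤s z≤n) t<len)))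
    ; injective = λ {s} {t} s≤len t≤len eq → ∸-cancelˡ-≡ s≤len t≤len
                                               (injective p (m∸n≤m len s) (m∸n≤m len t) eq)
    }

  module Concat {i j} (p : Path i) (q : Path j) (meet : vertex p i ≡ vertex q 0)
                (disjoint : ∀ {s t} → s < i → t ≤ j → vertex p s ≢ vertex q t) where

    glued : ℕ → Fin n
    glued t with t <? i
    ... | yes _ = vertex p t
    ... | no  _ = vertex q (t ∸ i)

    glued-right : ∀ {t} → i ≤ t → glued t ≡ vertex q (t ∸ i)
    glued-right {t} i≤t with t <? i
    ... | yes t<i = contradiction i≤t (<⇒≱ t<i)
    ... | no  _   = refl

    glued-left : ∀ {t} → t ≤ i → glued t ≡ vertex p t
    glued-left {t} t≤i with t <? i
    ... | yes _   = refl
    ... | no  t≮i = begin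
      vertex q (t ∸ i) ≡⟨ cong (vertex q) (m≤n⇒m∸n≡0 t≤i) ⟩
      vertex q 0       ≡⟨ sym meet ⟩
      vertex p i       ≡⟨ cong (vertex p) (≤-antisym (≮⇒≥ t≮i) t≤i) ⟩
      vertex p t       ∎
      where open ≡-Reasoning

    glued-linked : ∀ t → t < i + j → adj G (glued t) (glued (suc t)) ≡ true
    glued-linked t t<i+j = by-cases (suc t ≤? i)
      where
      by-cases : Dec (suc t ≤ i) → adj G (glued t) (glued (suc t)) ≡ true
      by-cases (yes t<i) = subst₂ (λ u v → adj G u v ≡ true) (sym (glued-left (<⇒≤ t<i)))
                             (sym (glued-left t<i)) (linked p t t<i)
      by-cases (no  t≮i) = subst₂ (λ u v → adj G u v ≡ true) (sym (glued-right i≤t))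
                             (sym (trans (glued-right (m≤n⇒m≤1+n i≤t)) (cong (vertex q) (+-∸-assoc 1 i≤t))))
                             (linked q (t ∸ i) (subst (t ∸ i <_) (m+n∸m≡n i j) (∸-monoˡ-< t<i+j i≤t)))
        where
        i≤t : i ≤ t
        i≤t = ≤-pred (≰⇒> t≮i)

    glued-injective : ∀ {s t} → s ≤ i + j → t ≤ i + j → glued s ≡ glued t → s ≡ t
    glued-injective {s} {t} s≤ t≤ eq = by-cases (s <? i) (t <? i)
      where
      by-cases : Dec (s < i) → Dec (t < i) → s ≡ t
      by-cases (yes s<i) (yes t<i) = injective p (<⇒≤ s<i) (<⇒≤ t<i)
        (trans (sym (glued-left (<⇒≤ s<i))) (trans eq (glued-left (<⇒≤ t<i))))
      by-cases (yes s<i) (no  t≮i) = contradiction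
        (trans (sym (glued-left (<⇒≤ s<i))) (trans eq (glued-right (≮⇒≥ t≮i))))
        (disjoint s<i (m≤n+o⇒m∸n≤o t i t≤))
      by-cases (no  s≮i) (yes t<i) = contradiction
        (trans (sym (glued-left (<⇒≤ t<i))) (trans (sym eq) (glued-right (≮⇒≥ s≮i))))
        (disjoint t<i (m≤n+o⇒m∸n≤o s i s≤))
      by-cases (no  s≮i) (no  t≮i) = ∸-cancelʳ-≡ (≮⇒≥ s≮i) (≮⇒≥ t≮i)
        (injective q (m≤n+o⇒m∸n≤o s i s≤) (m≤n+o⇒m∸n≤o t i t≤)
          (trans (sym (glued-right (≮⇒≥ s≮i))) (trans eq (glued-right (≮⇒≥ t≮i)))))

    concat : Path (i + j)
    concat = record { vertex = glued ; linked = glued-linked ; injective = glued-injective }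

  closed-path⇒Cycle : ∀ {len} (p : Path len) → 2 ≤ len → adj G (vertex p len) (vertex p 0) ≡ true → Cycle G
  closed-path⇒Cycle {len} p 2≤len closing = suc len , s≤s 2≤len , f , f-injective , f-linked
    where
    f : Fin (suc len) → Fin n
    f q = vertex p (toℕ q)

    toℕ≤len : (q : Fin (suc len)) → toℕ q ≤ len
    toℕ≤len q = ≤-pred (toℕ<n q)

    f-injective : Injective _≡_ _≡_ f
    f-injective eq = toℕ-injective (injective p (toℕ≤len _) (toℕ≤len _) eq)

    f-linked : ∀ q q' → suc (toℕ q) ≡ toℕ q' ⊎ (suc (toℕ q) ≡ suc len × toℕ q' ≡ 0) →
               adj G (f q) (f q') ≡ true
    f-linked q q' (inj₁ next) = subst (λ t → adj G (f q) (vertex p t) ≡ true) next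
                                  (linked p (toℕ q) (subst (_≤ len) (sym next) (toℕ≤len q')))
    f-linked q q' (inj₂ (last , first)) = subst₂ (λ s t → adj G (vertex p s) (vertex p t) ≡ true)
                                            (sym (suc-injective last)) (sym first) closing

module Tree {n : ℕ} (G : Graph n) (r : Fin n) (tree : IsTree G) where
  open Neighbourhood G
  open Depth G r (proj₁ tree) public
  open Paths G

  ancestor-path : ∀ x {ℓ} → ℓ ≤ depth x → Path ℓ
  ancestor-path x ℓ≤d = record
    { vertex    = λ t → ancestor t x
    ; linked    = λ t t<ℓ → ancestor-adj t x (≤-trans t<ℓ ℓ≤d)
    ; injective = λ s≤ℓ t≤ℓ → ancestor-injective x (≤-trans s≤ℓ ℓ≤d) (≤-trans t≤ℓ ℓ≤d)
    }

  module NonParentNeighbour {x k c} (d≡1+k : depth x ≡ suc k) (xc : adj G x c ≡ true)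
                            (c≢parent : c ≢ parent x) (shallow : depth c ≤ depth x) where

    -- the t-th ancestor of c lies on the root path of x
    Meets : ℕ → Set
    Meets t = ancestor t c ≡ ancestor (depth x ∸ depth (ancestor t c)) x

    meets-at-root : Meets (depth c)
    meets-at-root = begin
      ancestor (depth c) c                                ≡⟨ ancestor-depth≡root c ⟩
      r                                                   ≡⟨ ancestor-depth≡root x ⟨
      ancestor (depth x) x                                ≡⟨ cong (λ b → ancestor (depth x ∸ b) x) top≡0 ⟨
      ancestor (depth x ∸ depth (ancestor (depth c) c)) x ∎
      where
      open ≡-Reasoning
      top≡0 : depth (ancestor (depth c) c) ≡ 0
      top≡0 = trans (cong depth (ancestor-depth≡root c)) depth-root

    ¬meets-at-0 : ¬ Meets 0
    ¬meets-at-0 meets with depth x ∸ depth c | δ≤1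
      where
      δ≤1 : depth x ∸ depth c ≤ 1
      δ≤1 = m≤n+o⇒m∸n≤o (depth x) (depth c) (subst (depth x ≤_) (+-comm 1 (depth c)) (depth-adj xc))
    ... | 0 | _ = adj⇒≢ xc (sym meets)
    ... | 1 | _ = c≢parent meets
    ... | suc (suc _) | s≤s ()

    meets⇒ : ∀ {s a} → a ≤ depth x → ancestor s c ≡ ancestor a x → Meets s
    meets⇒ {s} {a} a≤d eq = trans eq (cong (λ b → ancestor b x) (sym same-depth))
      where
      same-depth : depth x ∸ depth (ancestor s c) ≡ a
      same-depth = trans (cong (λ b → depth x ∸ depth b) eq)
                         (trans (cong (depth x ∸_) (depth-ancestor a x a≤d)) (m∸[m∸n]≡n a≤d))

    first-meeting : ∃ λ j → Meets j × (∀ t → t < j → ¬ Meets t)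
    first-meeting = least {P = Meets} (λ t → ancestor t c ≟ᶠ ancestor (depth x ∸ depth (ancestor t c)) x)
                          {depth c} meets-at-root

    j : ℕ
    j = proj₁ first-meeting

    meets-j : Meets j
    meets-j = proj₁ (proj₂ first-meeting)

    before-j : ∀ t → t < j → ¬ Meets t
    before-j = proj₂ (proj₂ first-meeting)

    1≤j : 1 ≤ j
    1≤j = n≢0⇒n>0 (λ j≡0 → ¬meets-at-0 (subst Meets j≡0 meets-j))

    j≤depth : j ≤ depth c
    j≤depth = ≮⇒≥ (λ d<j → before-j (depth c) d<j meets-at-root)

    i : ℕ
    i = depth x ∸ depth (ancestor j c)

    1≤i : 1 ≤ i
    1≤i = m<n⇒0<n∸m (begin-strict
      depth (ancestor j c) ≡⟨ depth-ancestor j c j≤depth ⟩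
      depth c ∸ j          ≤⟨ ∸-monoʳ-≤ (depth c) 1≤j ⟩
      depth c ∸ 1          ≤⟨ m≤n+o⇒m∸n≤o (depth c) 1 (subst (depth c ≤_) d≡1+k shallow) ⟩
      k                    <⟨ n<1+n k ⟩
      suc k                ≡⟨ d≡1+k ⟨
      depth x              ∎)
      where open ≤-Reasoning

    i≤depth : i ≤ depth x
    i≤depth = m∸n≤m (depth x) (depth (ancestor j c))

    up : Path j
    up = ancestor-path c j≤depth

    down : Path i
    down = reverse (ancestor-path x i≤depth)

    disjoint : ∀ {s t} → s < j → t ≤ i → vertex up s ≢ vertex down t
    disjoint {s} {t} s<j _ eq = before-j s s<j (meets⇒ {s} (≤-trans (m∸n≤m i t) i≤depth) eq)

    open Concat up down meets-j disjoint

    cycle : Cycle G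
    cycle = closed-path⇒Cycle concat (+-mono-≤ 1≤j 1≤i)
      (subst₂ (λ u v → adj G u v ≡ true) (sym glued-last) (sym (glued-left z≤n)) xc)
      where
      glued-last : glued (j + i) ≡ x
      glued-last = begin
        glued (j + i)                ≡⟨ glued-right (m≤m+n j i) ⟩
        ancestor (i ∸ (j + i ∸ j)) x ≡⟨ cong (λ t → ancestor (i ∸ t) x) (m+n∸m≡n j i) ⟩
        ancestor (i ∸ i) x           ≡⟨ cong (λ t → ancestor t x) (n∸n≡0 i) ⟩
        x                            ∎
        where open ≡-Reasoning

  parent-unique : ∀ {x k c} → depth x ≡ suc k → adj G x c ≡ true → depth c ≤ depth x → c ≡ parent x
  parent-unique {x} {k} {c} d≡1+k xc shallow with c ≟ᶠ parent x
  ... | yes c≡parent = c≡parent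
  ... | no  c≢parent = contradiction (NonParentNeighbour.cycle d≡1+k xc c≢parent shallow) (proj₂ tree)

  child-depth : ∀ {x k c} → depth x ≡ suc k → adj G x c ≡ true → c ≢ parent x → depth c ≡ suc (depth x)
  child-depth d≡1+k xc c≢parent =
    ≤-antisym (depth-adj (adj-sym xc)) (≰⇒> (c≢parent ∘ parent-unique d≡1+k xc))

  edge-to-parent : ∀ {x y} → adj G x y ≡ true → depth x ≤ depth y → ∃ λ k → depth y ≡ suc k × x ≡ parent y
  edge-to-parent {x} {y} xy x≤y with depth-nonroot y≢r
    where
    y≢r : y ≢ r
    y≢r refl = adj⇒≢ xy (depth≡0⇒root (n≤0⇒n≡0 (subst (depth x ≤_) depth-root x≤y)))
  ... | k , d≡1+k = k , d≡1+k , parent-unique d≡1+k (adj-sym xy) x≤y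

dominating-with-total-complement⇒DTDP : ∀ {n} (G : Graph n) (D : Fin n → Bool) → Dominating G D →
  (∀ x → ∃ λ y → adj G x y ≡ true × D y ≡ false) → DTDP G
dominating-with-total-complement⇒DTDP G D dominating complement-total =
  D , not ∘ D , disjoint , dominating , total
  where
  disjoint : Disjoint G D (not ∘ D)
  disjoint x (Dx , notDx) = contradiction (cong not Dx) (not-¬ notDx)
  total : TotalDominating G (not ∘ D)
  total x = let y , xy , Dy = complement-total x in y , xy , cong not Dy

module ResidueDominatingSet {n : ℕ} (T : Graph n) (r : Fin n) (tree : IsTree T)
  (1≤leafNbrs : 1 ≤ leafNbrs T r) (leafNbrs≤deg∸1 : leafNbrs T r ≤ deg T r ∸ 1)
  (leaf-residue : ∀ x → isLeaf T x ≡ true → adj T r x ≡ false → ∀ k → Dist T x r k → k % 3 ≡ 2) where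
  open Neighbourhood T
  open Tree T r tree

  inD : Fin n → Bool
  inD y = does (depth y % 3 ≟ 2) ∨ (adj T r y ∧ isLeaf T y)

  ∈D-residue : ∀ {y m} → depth y ≡ m → m % 3 ≡ 2 → inD y ≡ true
  ∈D-residue {y} refl ≡2 = cong (_∨ (adj T r y ∧ isLeaf T y)) (dec-true (depth y % 3 ≟ 2) ≡2)

  ∈D-rootLeaf : ∀ {y} → adj T r y ≡ true → isLeaf T y ≡ true → inD y ≡ true
  ∈D-rootLeaf {y} ry leaf = trans (cong₂ (λ a b → does (depth y % 3 ≟ 2) ∨ (a ∧ b)) ry leaf) (∨-zeroʳ _)

  ∉D : ∀ {y m} → depth y ≡ m → m % 3 ≢ 2 → adj T r y ≡ false ⊎ isLeaf T y ≡ false → inD y ≡ false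
  ∉D {y} refl ≢2 ¬rootLeaf = cong₂ _∨_ (dec-false (depth y % 3 ≟ 2) ≢2) (not-both ¬rootLeaf)
    where
    not-both : adj T r y ≡ false ⊎ isLeaf T y ≡ false → (adj T r y ∧ isLeaf T y) ≡ false
    not-both (inj₁ ry) = cong (_∧ isLeaf T y) ry
    not-both (inj₂ leaf) = trans (cong (adj T r y ∧_) leaf) (∧-zeroʳ _)

  depth≢1⇒¬adj-root : ∀ {y m} → depth y ≡ m → m ≢ 1 → adj T r y ≡ false
  depth≢1⇒¬adj-root {y} refl d≢1 with adj T r y in ry
  ... | false = refl
  ... | true  = contradiction (adj-root⇒depth≡1 ry) d≢1

  Covered : Fin n → Set
  Covered x = (inD x ≡ false → ∃ λ y → adj T x y ≡ true × inD y ≡ true)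
            × (∃ λ y → adj T x y ≡ true × inD y ≡ false)

  root-covered : Covered r
  root-covered = (λ _ → let y , ry , leaf = leaf-neighbour r 1≤leafNbrs in y , ry , ∈D-rootLeaf ry leaf)
               , (let y , ry , ¬leaf = nonLeaf-neighbour r 1≤leafNbrs leafNbrs≤deg∸1
                  in y , ry , ∉D (adj-root⇒depth≡1 ry) (λ ()) (inj₂ ¬leaf))

  rootLeaf-covered : ∀ {x} → adj T r x ≡ true → isLeaf T x ≡ true → Covered x
  rootLeaf-covered rx leaf = (λ x∉D → contradiction x∉D (not-¬ (∈D-rootLeaf rx leaf)))
                           , r , adj-sym rx , ∉D depth-root (λ ()) (inj₁ (Graph.irrefl T r))

  module _ {x k} (x≢r : x ≢ r) (d≡1+k : depth x ≡ suc k)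
           (¬rootLeaf : adj T r x ≡ false ⊎ isLeaf T x ≡ false) where

    xp : adj T x (parent x) ≡ true
    xp = parent-adj d≡1+k

    dp≡k : depth (parent x) ≡ k
    dp≡k = depth-parent d≡1+k

    residue≢2⇒¬leaf : suc k % 3 ≢ 2 → isLeaf T x ≡ false
    residue≢2⇒¬leaf ≢2 = by-cases ¬rootLeaf
      where
      by-cases : adj T r x ≡ false ⊎ isLeaf T x ≡ false → isLeaf T x ≡ false
      by-cases (inj₂ ¬leaf) = ¬leaf
      by-cases (inj₁ rx) with isLeaf T x in leaf
      ... | false = refl
      ... | true  = contradiction (subst (λ m → m % 3 ≡ 2) d≡1+k (leaf-residue x leaf rx _ (depth-dist x))) ≢2

    residue≢2⇒child : suc k % 3 ≢ 2 → ∃ λ c → adj T x c ≡ true × depth c ≡ suc (suc k)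
    residue≢2⇒child ≢2 with nonLeaf⇒other-neighbour xp (residue≢2⇒¬leaf ≢2)
    ... | c , xc , c≢p = c , xc , trans (child-depth d≡1+k xc c≢p) (cong suc d≡1+k)

    nonroot-covered : Covered x
    nonroot-covered with %3-consecutive k
    ... | inj₁ (k≡0 , x≡1 , c≡2) =
      (λ _ → let c , xc , dc = residue≢2⇒child (subst (_≢ 2) (sym x≡1) λ ()) in c , xc , ∈D-residue dc c≡2)
      , parent x , xp , ∉D dp≡k (subst (_≢ 2) (sym k≡0) λ ()) (inj₁ (depth≢1⇒¬adj-root dp≡k k≢1))
      where
      k≢1 : k ≢ 1
      k≢1 k≡1 = contradiction (subst (λ m → m % 3 ≡ 0) k≡1 k≡0) λ ()
    ... | inj₂ (inj₁ (k≡1 , x≡2 , _)) =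
      (λ x∉D → contradiction x∉D (not-¬ (∈D-residue d≡1+k x≡2)))
      , parent x , xp , ∉D dp≡k (subst (_≢ 2) (sym k≡1) λ ()) parent-not-rootLeaf
      where
      parent-not-rootLeaf : adj T r (parent x) ≡ false ⊎ isLeaf T (parent x) ≡ false
      parent-not-rootLeaf with adj T r (parent x) in rp
      ... | false = inj₁ refl
      ... | true  = inj₂ (two-neighbours⇒¬leaf (adj-sym rp) (adj-sym xp) (x≢r ∘ sym))
    ... | inj₂ (inj₂ (k≡2 , x≡0 , c≡1)) =
      (λ _ → parent x , xp , ∈D-residue dp≡k k≡2)
      , (let c , xc , dc = residue≢2⇒child (subst (_≢ 2) (sym x≡0) λ ())
         in c , xc , ∉D dc (subst (_≢ 2) (sym c≡1) λ ()) (inj₁ (depth≢1⇒¬adj-root dc λ ())))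

  covered : ∀ x → Covered x
  covered x with x ≟ᶠ r
  ... | yes refl = root-covered
  ... | no  x≢r with depth-nonroot x≢r | adj T r x ≟ᵇ true | isLeaf T x ≟ᵇ true
  ...   | _ , _     | yes rx  | yes leaf  = rootLeaf-covered rx leaf
  ...   | _ , d≡1+k | no  ¬rx | _         = nonroot-covered x≢r d≡1+k (inj₁ (¬-not ¬rx))
  ...   | _ , d≡1+k | yes _   | no  ¬leaf = nonroot-covered x≢r d≡1+k (inj₂ (¬-not ¬leaf))

  residue-DTDP : DTDP T
  residue-DTDP = dominating-with-total-complement⇒DTDP T inD (proj₁ ∘ covered) (proj₂ ∘ covered)

isolated-vertex⇒¬DTPair : ∀ {n} (H : Graph n) {D S a} → (∀ z → adj H a z ≢ true) → ¬ DTPair H D S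
isolated-vertex⇒¬DTPair H {a = a} isolated (_ , _ , total) = let z , az , _ = total a in isolated z az

isolated-edge⇒¬DTPair : ∀ {n} (H : Graph n) {D S a b} →
  (∀ z → adj H a z ≡ true → z ≡ b) → (∀ z → adj H b z ≡ true → z ≡ a) → ¬ DTPair H D S
isolated-edge⇒¬DTPair H {D} {S} {a} {b} only-b only-a (disjoint , dominating , total) with D a in Da
... | true  = disjoint a (Da , Sa)
  where
  Sa : S a ≡ true
  Sa = let z , bz , Sz = total b in subst (λ v → S v ≡ true) (only-a z bz) Sz
... | false = let z , az , Dz = dominating a Da in disjoint b (subst (λ v → D v ≡ true) (only-b z az) Dz , Sb)
  where
  Sb : S b ≡ true
  Sb = let z , az , Sz = total a in subst (λ v → S v ≡ true) (only-b z az) Sz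

module WoundedSpider {n : ℕ} (T : Graph n) (r : Fin n) (tree : IsTree T)
  (deg≤2 : ∀ x → x ≢ r → deg T x ≤ 2)
  (1≤leafNbrs : 1 ≤ leafNbrs T r) (leafNbrs≤deg∸1 : leafNbrs T r ≤ deg T r ∸ 1)
  (leaf-depth : ∀ x → isLeaf T x ≡ true → adj T r x ≡ false → ∀ k → Dist T x r k → k ≡ 2) where
  open Neighbourhood T
  open Tree T r tree
  open ResidueDominatingSet T r tree 1≤leafNbrs leafNbrs≤deg∸1
    (λ x leaf rx k dist → cong (_% 3) (leaf-depth x leaf rx k dist)) using (residue-DTDP)

  deepest-depth≤2 : ∀ y → (∀ z → depth z ≤ depth y) → depth y ≤ 2
  deepest-depth≤2 y deepest with y ≟ᶠ r
  ... | yes refl = subst (_≤ 2) (sym depth-root) z≤n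
  ... | no  y≢r with depth-nonroot y≢r | isLeaf T y ≟ᵇ true | adj T r y ≟ᵇ true
  ...   | _ , _     | yes _    | yes ry  = subst (_≤ 2) (sym (adj-root⇒depth≡1 ry)) (s≤s z≤n)
  ...   | _ , _     | yes leaf | no  ¬ry = ≤-reflexive (leaf-depth y leaf (¬-not ¬ry) _ (depth-dist y))
  ...   | _ , d≡1+k | no ¬leaf | _ =
    let c , yc , c≢p = nonLeaf⇒other-neighbour (parent-adj d≡1+k) (¬-not ¬leaf)
    in contradiction (subst (_≤ depth y) (child-depth d≡1+k yc c≢p) (deepest c)) 1+n≰n

  depth≤2 : ∀ z → depth z ≤ 2
  depth≤2 z = ≤-trans (≤-max z) (deepest-depth≤2 (argmax depth r (allFin n)) ≤-max)
    where
    ≤-max : ∀ z → depth z ≤ depth (argmax depth r (allFin n))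
    ≤-max z = All.lookup (f[xs]≤f[argmax] r (allFin n)) (∈-allFin z)

  module _ (H : Graph n) (H⊆T : ∀ x y → adj H x y ≡ true → adj T x y ≡ true)
           {ch k} (d≡1+k : depth ch ≡ suc k) (¬Hchp : adj H ch (parent ch) ≡ false) where

    chp : adj T ch (parent ch) ≡ true
    chp = parent-adj d≡1+k

    leaf-isolated : isLeaf T ch ≡ true → ∀ z → adj H ch z ≢ true
    leaf-isolated leaf z Hchz = contradiction ¬Hchp
      (not-¬ (subst (λ v → adj H ch v ≡ true) (leaf-neighbour-unique leaf (H⊆T _ _ Hchz) chp) Hchz))

    module _ {c} (chc : adj T ch c ≡ true) (c≢p : c ≢ parent ch) where

      c-leaf : isLeaf T c ≡ true
      c-leaf with isLeaf T c ≟ᵇ true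
      ... | yes leaf = leaf
      ... | no  ¬leaf =
        let w , cw , w≢p = nonLeaf⇒other-neighbour (parent-adj dc) (¬-not ¬leaf)
        in contradiction (subst (_≤ 2) (trans (child-depth dc cw w≢p) (cong suc dc)) (depth≤2 w))
                         λ { (s≤s (s≤s ())) }
        where
        dc : depth c ≡ suc (suc k)
        dc = trans (child-depth d≡1+k chc c≢p) (cong suc d≡1+k)

      ch-only-c : ∀ z → adj H ch z ≡ true → z ≡ c
      ch-only-c z Hchz with deg≤2⇒neighbour∈ (deg≤2 ch ch≢r) chp chc (H⊆T _ _ Hchz) (c≢p ∘ sym)
        where
        ch≢r : ch ≢ r
        ch≢r refl = 0≢1+n (trans (sym depth-root) d≡1+k)
      ... | inj₂ z≡c  = z≡c
      ... | inj₁ refl = contradiction ¬Hchp (not-¬ Hchz)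

      c-only-ch : ∀ z → adj H c z ≡ true → z ≡ ch
      c-only-ch z Hcz = leaf-neighbour-unique c-leaf (H⊆T _ _ Hcz) (adj-sym chc)

    parent-edge-removed⇒¬DTPair : ∀ {D S} → ¬ DTPair H D S
    parent-edge-removed⇒¬DTPair with isLeaf T ch ≟ᵇ true
    ... | yes leaf  = isolated-vertex⇒¬DTPair H (leaf-isolated leaf)
    ... | no  ¬leaf =
      let c , chc , c≢p = nonLeaf⇒other-neighbour chp (¬-not ¬leaf)
      in isolated-edge⇒¬DTPair H (ch-only-c chc c≢p) (c-only-ch chc c≢p)

  minimal : MinimalDTDP T
  minimal = proj₁ tree , residue-DTDP , λ H (H⊆T , x , y , xy , ¬Hxy) (_ , _ , pair) →
    case-on-depths H H⊆T xy ¬Hxy pair (≤-total (depth x) (depth y))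
    where
    case-on-depths : ∀ (H : Graph n) {D S x y} → (∀ x y → adj H x y ≡ true → adj T x y ≡ true) →
      adj T x y ≡ true → adj H x y ≡ false → DTPair H D S → depth x ≤ depth y ⊎ depth y ≤ depth x → ⊥
    case-on-depths H H⊆T xy ¬Hxy pair (inj₁ x≤y) with edge-to-parent xy x≤y
    ... | _ , d≡1+k , refl = parent-edge-removed⇒¬DTPair H H⊆T d≡1+k (trans (Graph.sym H _ _) ¬Hxy) pair
    case-on-depths H H⊆T xy ¬Hxy pair (inj₂ y≤x) with edge-to-parent (adj-sym xy) y≤x
    ... | _ , d≡1+k , refl = parent-edge-removed⇒¬DTPair H H⊆T d≡1+k ¬Hxy pair

corollary3p2 : (∀ (n : ℕ) (T : Graph n) (r : Fin n) → IsTree T →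
    (∀ x → x ≢ r → deg T x ≤ 2) →
    1 ≤ leafNbrs T r → leafNbrs T r ≤ deg T r ∸ 1 →
    (∀ x → isLeaf T x ≡ true → adj T r x ≡ false → ∀ k → Dist T x r k → k % 3 ≡ 2) →
    DTDP T)
    ×
    (∀ (n : ℕ) (T : Graph n) (r : Fin n) → IsTree T →
    (∀ x → x ≢ r → deg T x ≤ 2) →
    1 ≤ leafNbrs T r → leafNbrs T r ≤ deg T r ∸ 1 →
    (∀ x → isLeaf T x ≡ true → adj T r x ≡ false → ∀ k → Dist T x r k → k ≡ 2) →
    MinimalDTDP T)
corollary3p2 = (λ n T r tree _ 1≤l l≤d∸1 leaf-residue →
                  ResidueDominatingSet.residue-DTDP T r tree 1≤l l≤d∸1 leaf-residue)
             , (λ n T r tree deg≤2 1≤l l≤d∸1 leaf-depth →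
                  WoundedSpider.minimal T r tree deg≤2 1≤l l≤d∸1 leaf-depth)
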